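{- Let $w=w_1\dots w_{p-1}$ be a word over $\Sigma$ such that $p=|w|+1$ is prime, and let $d\in\Sigma$. Then $\mathrm{T}(w\,\rho_d)$ is completely additive if and only if $w_k=w_i+w_j$ for all $i,j,k$ with $0<i,j,k<p$ and $k\equiv ij\pmod p$.
   Context: $\Sigma$ is a finite cyclic group; gaps are bijections of $\Sigma$, $?$ the identity, $\rho_d$ the bijection $x\mapsto x+d$. For words $x,y$ over $\Sigma\cup\mathrm{S}_\Sigma$: $(a\,x)\langle y\rangle=a\,x\langle y\rangle$, $(f\,x)\langle b\,y\rangle=f(b)\,x\langle y\rangle$, $(f\,x)\langle g\,y\rangle=(f\circ g)\,x\langle y\rangle$. For a pattern $P$ with first symbol in $\Sigma$: $T_0=?^\omega$, $T_{i+1}=P^\omega\langle T_i\rangle$, $\mathrm{T}(P)=\lim T_i$, indexed by positive integers. Completely additive: $\sigma(1)=0$, $\sigma(nm)=\sigma(n)+\sigma(m)$ for all $n,m\ge1$. -}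

module Defs where

open import Data.Nat using (ℕ; zero; suc; _+_; _*_; _∸_; _≤_)
open import Data.Nat.DivMod using (_mod_; _%_)
open import Data.Fin using (Fin; toℕ) renaming (zero to fzero)
open import Data.Vec using (Vec; lookup; map; _∷ʳ_)
open import Data.Product using (_×_; ∃)
open import Relation.Binary.PropositionalEquality using (_≡_)
open import Function using (_∘_; id)

-- The finite cyclic group Σ, taken as ℤ/(suc m)ℤ represented by Fin (suc m).
Grp : ℕ → Set
Grp m = Fin (suc m)

infixl 6 _⊕_
_⊕_ : ∀ {m} → Grp m → Grp m → Grp m
_⊕_ {m} a b = (toℕ a + toℕ b) mod suc m

-- Symbols: letters of Σ, or gaps (maps Σ → Σ; all gaps occurring here are
-- compositions of the identity and ρ_d, hence bijections).
data Sym (m : ℕ) : Set where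
  letter : Grp m → Sym m
  gap    : (Grp m → Grp m) → Sym m

ρ : ∀ {m} → Grp m → Grp m → Grp m
ρ d x = x ⊕ d

-- Infinite words; index n holds the symbol at position n+1.
Word : ℕ → Set
Word m = ℕ → Sym m

gapCount : ∀ {m} → Word m → ℕ → ℕ
gapCount x zero = 0
gapCount x (suc n) with x n
... | letter _ = gapCount x n
... | gap _    = suc (gapCount x n)

_⟨_⟩ : ∀ {m} → Word m → Word m → Word m
(x ⟨ y ⟩) n with x n
... | letter a = letter a
... | gap f with y (gapCount x n)
...   | letter b = letter (f b)
...   | gap g    = gap (f ∘ g)

_^ω : ∀ {m k} → Vec (Sym m) (suc k) → Word m
_^ω {k = k} P n = lookup P (n mod suc k)

Tseq : ∀ {m k} → Vec (Sym m) (suc k) → ℕ → Word m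
Tseq P zero    = λ _ → gap id
Tseq P (suc i) = (P ^ω) ⟨ Tseq P i ⟩

IsToeplitzLimit : ∀ {m k} → Vec (Sym m) (suc k) → (ℕ → Grp m) → Set
IsToeplitzLimit P t = ∀ n → ∃ λ N → ∀ i → N ≤ i → Tseq P i n ≡ letter (t n)

pattern-wρ : ∀ {m n} → Vec (Grp m) n → Grp m → Vec (Sym m) (suc n)
pattern-wρ w d = map letter w ∷ʳ gap (ρ d)

-- complete additivity of σ, where σ(a) = t (a - 1) for a ≥ 1
CompletelyAdditive : ∀ {m} → (ℕ → Grp m) → Set
CompletelyAdditive t =
  (t 0 ≡ fzero) × (∀ a b → t (suc a * suc b ∸ 1) ≡ t a ⊕ t b)

-- w_k = w_i + w_j whenever 0<i,j,k<p and k ≡ ij (mod p), p = n+1;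
-- index i : Fin n stands for position suc (toℕ i).
MultCondition : ∀ {m n} → Vec (Grp m) n → Set
MultCondition {n = n} w = ∀ (i j k : Fin n) →
  suc (toℕ k) % suc n ≡ (suc (toℕ i) * suc (toℕ j)) % suc n →
  lookup w k ≡ lookup w i ⊕ lookup w j

module Submission where

-- Let p = N + 1 be prime and P = w ρ_d with w = w₀ … w_{N-1}.  We index the
-- Toeplitz word from 0, so t x is σ(x + 1).
--
-- 1. Arithmetic of ⊕ on Grp m = ℤ/(m+1): commutativity, associativity, and
--    that the only idempotent is 0.
-- 2. Every position x is either "low", x = j + q·p with j < N, or "high",
--    x = N + q·p.  For a prime p a product (a+1)(b+1) of two factors prime to
--    p is again prime to p, and its residue is the product of the residues.
-- 3. For any pattern w f (letters w, then one gap f) the sequence T_i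
--    stabilises pointwise, and its limit t is characterised by the
--    self-similarity t (j + q·p) = w_j and t (N + q·p) = f (t q), i.e.
--    σ(n) = w_{n mod p} for p ∤ n and σ(p·n) = f(σ(n)).
-- 4. For any t with this self-similarity (f = ρ_d), complete additivity is
--    equivalent to the multiplicativity condition on w: one direction reads
--    off σ on 1 … p-1, the other is an induction on a + b, peeling off a
--    factor p (which contributes d on both sides) until both factors are
--    prime to p, where the condition on w applies directly.

open import Defs
open import Data.Nat using (ℕ; suc; zero; _+_; _*_; _∸_; _≤_; _<_; z≤n; s≤s; _<?_)
open import Data.Nat.Properties
open import Data.Nat.DivMod
open import Data.Nat.Divisibility using (_∣_; ∣⇒≤; ∣m+n∣m⇒∣n; n∣m*n; divides)
open import Data.Nat.Primality using (Prime; euclidsLemma; ¬prime[1])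
open import Data.Fin using (Fin; toℕ; fromℕ<; fromℕ; inject₁) renaming (zero to fzero; suc to fsuc)
open import Data.Fin.Properties using (toℕ-injective; toℕ<n; toℕ-fromℕ<; toℕ-fromℕ; toℕ-inject₁)
open import Data.Vec using (Vec; lookup; map; _∷ʳ_; _∷_; [])
open import Data.Vec.Properties using (lookup-map)
open import Data.Product using (Σ-syntax; _×_; _,_; proj₁; proj₂)
open import Data.Sum using (inj₁; inj₂)
open import Data.Empty using (⊥-elim)
open import Relation.Nullary using (yes; no; ¬_)
open import Relation.Binary.PropositionalEquality
open import Function.Bundles using (_⇔_; mk⇔)
open import Data.Nat.Tactic.RingSolver using (solve-∀)

-- 1. The cyclic group ℤ/(m+1)

module CyclicGroup (m : ℕ) where

  private
    s : ℕ
    s = suc m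

  toℕ-⊕ : (a b : Grp m) → toℕ (a ⊕ b) ≡ (toℕ a + toℕ b) % s
  toℕ-⊕ a b = toℕ-fromℕ< _

  %-absorbˡ : ∀ x y → (x % s + y) % s ≡ (x + y) % s
  %-absorbˡ x y = begin
    (x % s + y) % s         ≡⟨ %-distribˡ-+ (x % s) y s ⟩
    (x % s % s + y % s) % s ≡⟨ cong (λ z → (z + y % s) % s) (m%n%n≡m%n x s) ⟩
    (x % s + y % s) % s     ≡⟨ %-distribˡ-+ x y s ⟨
    (x + y) % s             ∎
    where open ≡-Reasoning

  %-absorbʳ : ∀ x y → (x + y % s) % s ≡ (x + y) % s
  %-absorbʳ x y = begin
    (x + y % s) % s ≡⟨ cong (_% s) (+-comm x (y % s)) ⟩
    (y % s + x) % s ≡⟨ %-absorbˡ y x ⟩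
    (y + x) % s     ≡⟨ cong (_% s) (+-comm y x) ⟩
    (x + y) % s     ∎
    where open ≡-Reasoning

  ⊕-comm : (a b : Grp m) → a ⊕ b ≡ b ⊕ a
  ⊕-comm a b = cong (_mod s) (+-comm (toℕ a) (toℕ b))

  ⊕-assoc : (a b c : Grp m) → (a ⊕ b) ⊕ c ≡ a ⊕ (b ⊕ c)
  ⊕-assoc a b c = toℕ-injective (begin
    toℕ ((a ⊕ b) ⊕ c)                 ≡⟨ toℕ-⊕ (a ⊕ b) c ⟩
    (toℕ (a ⊕ b) + toℕ c) % s         ≡⟨ cong (λ z → (z + toℕ c) % s) (toℕ-⊕ a b) ⟩
    ((toℕ a + toℕ b) % s + toℕ c) % s ≡⟨ %-absorbˡ (toℕ a + toℕ b) (toℕ c) ⟩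
    (toℕ a + toℕ b + toℕ c) % s       ≡⟨ cong (_% s) (+-assoc (toℕ a) (toℕ b) (toℕ c)) ⟩
    (toℕ a + (toℕ b + toℕ c)) % s     ≡⟨ %-absorbʳ (toℕ a) (toℕ b + toℕ c) ⟨
    (toℕ a + (toℕ b + toℕ c) % s) % s ≡⟨ cong (λ z → (toℕ a + z) % s) (toℕ-⊕ b c) ⟨
    (toℕ a + toℕ (b ⊕ c)) % s         ≡⟨ toℕ-⊕ a (b ⊕ c) ⟨
    toℕ (a ⊕ (b ⊕ c))                 ∎)
    where open ≡-Reasoning

  ⊕-exchange : (a b c : Grp m) → (a ⊕ b) ⊕ c ≡ (a ⊕ c) ⊕ b
  ⊕-exchange a b c = begin
    (a ⊕ b) ⊕ c ≡⟨ ⊕-assoc a b c ⟩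
    a ⊕ (b ⊕ c) ≡⟨ cong (a ⊕_) (⊕-comm b c) ⟩
    a ⊕ (c ⊕ b) ≡⟨ ⊕-assoc a c b ⟨
    (a ⊕ c) ⊕ b ∎
    where open ≡-Reasoning

  -- x = x + x forces x = 0: writing u = toℕ x, u + u = u + k·s with u < s
  -- gives u = k·s, so k = 0.
  idempotent⇒zero : (x : Grp m) → x ≡ x ⊕ x → x ≡ fzero
  idempotent⇒zero x x≡x⊕x = toℕ-injective (multiple-below-s ((u + u) / s) u≡k*s)
    where
    u : ℕ
    u = toℕ x

    u≡k*s : u ≡ ((u + u) / s) * s
    u≡k*s = +-cancelˡ-≡ u u _ (begin
      u + u                          ≡⟨ m≡m%n+[m/n]*n (u + u) s ⟩
      (u + u) % s + (u + u) / s * s  ≡⟨ cong (_+ (u + u) / s * s) (toℕ-⊕ x x) ⟨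
      toℕ (x ⊕ x) + (u + u) / s * s  ≡⟨ cong (λ z → toℕ z + (u + u) / s * s) x≡x⊕x ⟨
      u + (u + u) / s * s            ∎)
      where open ≡-Reasoning

    multiple-below-s : ∀ k → u ≡ k * s → u ≡ 0
    multiple-below-s zero    u≡0 = u≡0
    multiple-below-s (suc k) u≡ks =
      ⊥-elim (<⇒≱ (toℕ<n x) (subst (s ≤_) (sym u≡ks) (m≤m+n s (k * s))))

-- 2. Positions modulo p = N + 1

module Positions (N : ℕ) where

  p : ℕ
  p = suc N

  -- Position x holds the residue class of x + 1 modulo p: "low" positions
  -- (x + 1 prime to p) and "high" positions (p ∣ x + 1).
  data View (x : ℕ) : Set where
    low  : (j : Fin N) (q : ℕ) → x ≡ toℕ j + q * p → View x
    high : (q : ℕ) → x ≡ N + q * p → View x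

  view : ∀ x → View x
  view x with x % p <? N
  ... | yes r<N = low (fromℕ< r<N) (x / p)
          (trans (m≡m%n+[m/n]*n x p) (cong (_+ (x / p) * p) (sym (toℕ-fromℕ< r<N))))
  ... | no r≮N = high (x / p)
          (trans (m≡m%n+[m/n]*n x p) (cong (_+ (x / p) * p) r≡N))
    where
    r≡N : x % p ≡ N
    r≡N = ≤-antisym (≤-pred (m%n<n x p)) (≮⇒≥ r≮N)

  quotient<high : 0 < N → ∀ q → q < N + q * p
  quotient<high N>0 q = ≤-trans (s≤s (m≤m*n q p)) (+-monoˡ-≤ (q * p) N>0)

  low-not-divisible : ∀ (j : Fin N) q → ¬ (p ∣ suc (toℕ j + q * p))
  low-not-divisible j q p∣x = <⇒≱ (s≤s (toℕ<n j)) (∣⇒≤ p∣suc-j)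
    where
    p∣suc-j : p ∣ suc (toℕ j)
    p∣suc-j = ∣m+n∣m⇒∣n
      (subst (p ∣_) (trans (cong suc (+-comm (toℕ j) (q * p))) (sym (+-suc (q * p) (toℕ j)))) p∣x)
      (n∣m*n q)

  residue-injective : ∀ (k k′ : Fin N) → suc (toℕ k) % p ≡ suc (toℕ k′) % p → k ≡ k′
  residue-injective k k′ eq = toℕ-injective (suc-injective (begin
    suc (toℕ k)      ≡⟨ m<n⇒m%n≡m (s≤s (toℕ<n k)) ⟨
    suc (toℕ k) % p  ≡⟨ eq ⟩
    suc (toℕ k′) % p ≡⟨ m<n⇒m%n≡m (s≤s (toℕ<n k′)) ⟩
    suc (toℕ k′)     ∎))
    where open ≡-Reasoning

  product-low : Prime p → ∀ {a b} (i j : Fin N) q₁ q₂ →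
    a ≡ toℕ i + q₁ * p → b ≡ toℕ j + q₂ * p →
    Σ[ k ∈ Fin N ] Σ[ q ∈ ℕ ] (suc a * suc b ∸ 1 ≡ toℕ k + q * p
      × suc (toℕ k) % p ≡ (suc (toℕ i) * suc (toℕ j)) % p)
  product-low p-prime {a} {b} i j q₁ q₂ a≡ b≡ with view (suc a * suc b ∸ 1)
  ... | high q ab≡ with euclidsLemma (suc a) (suc b) p-prime (divides (suc q) (cong suc ab≡))
  ...   | inj₁ p∣a = ⊥-elim (low-not-divisible i q₁ (subst (λ z → p ∣ suc z) a≡ p∣a))
  ...   | inj₂ p∣b = ⊥-elim (low-not-divisible j q₂ (subst (λ z → p ∣ suc z) b≡ p∣b))
  product-low p-prime {a} {b} i j q₁ q₂ a≡ b≡ | low k q ab≡ = k , q , ab≡ , (begin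
    suc (toℕ k) % p                  ≡⟨ [m+kn]%n≡m%n (suc (toℕ k)) q p ⟨
    suc (toℕ k + q * p) % p          ≡⟨ cong (λ z → suc z % p) ab≡ ⟨
    (suc a * suc b) % p              ≡⟨ %-distribˡ-* (suc a) (suc b) p ⟩
    (suc a % p * (suc b % p)) % p    ≡⟨ cong₂ (λ u v → (u * v) % p) (residue i q₁ a≡) (residue j q₂ b≡) ⟩
    (suc (toℕ i) % p * (suc (toℕ j) % p)) % p
                                     ≡⟨ %-distribˡ-* (suc (toℕ i)) (suc (toℕ j)) p ⟨
    (suc (toℕ i) * suc (toℕ j)) % p  ∎)
    where
    open ≡-Reasoning
    residue : ∀ {x} (r : Fin N) q → x ≡ toℕ r + q * p → suc x % p ≡ suc (toℕ r) % p
    residue r q refl = [m+kn]%n≡m%n (suc (toℕ r)) q p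

-- 3. The Toeplitz word of a pattern w f with a single trailing gap

lookup-∷ʳ-inject₁ : ∀ {A : Set} {k} (v : Vec A k) y (i : Fin k) → lookup (v ∷ʳ y) (inject₁ i) ≡ lookup v i
lookup-∷ʳ-inject₁ (x ∷ v) y fzero    = refl
lookup-∷ʳ-inject₁ (x ∷ v) y (fsuc i) = lookup-∷ʳ-inject₁ v y i

lookup-∷ʳ-last : ∀ {A : Set} {k} (v : Vec A k) y → lookup (v ∷ʳ y) (fromℕ k) ≡ y
lookup-∷ʳ-last []      y = refl
lookup-∷ʳ-last (x ∷ v) y = lookup-∷ʳ-last v y

gapCount-letter : ∀ {m} (x : Word m) n a → x n ≡ letter a → gapCount x (suc n) ≡ gapCount x n
gapCount-letter x n a eq rewrite eq = refl

gapCount-gap : ∀ {m} (x : Word m) n f → x n ≡ gap f → gapCount x (suc n) ≡ suc (gapCount x n)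
gapCount-gap x n f eq rewrite eq = refl

fill-letter : ∀ {m} (x y : Word m) n a → x n ≡ letter a → (x ⟨ y ⟩) n ≡ letter a
fill-letter x y n a eq rewrite eq = refl

fill-gap : ∀ {m} (x y : Word m) n f b →
  x n ≡ gap f → y (gapCount x n) ≡ letter b → (x ⟨ y ⟩) n ≡ letter (f b)
fill-gap x y n f b eq₁ eq₂ rewrite eq₁ | eq₂ = refl

letter-injective : ∀ {m} {a b : Grp m} → letter a ≡ letter b → a ≡ b
letter-injective refl = refl

module Toeplitz {m N : ℕ} (w : Vec (Grp m) N) (f : Grp m → Grp m) (N>0 : 0 < N) where

  open Positions N

  P : Vec (Sym m) (suc N)
  P = map letter w ∷ʳ gap f

  Pω-low : ∀ (j : Fin N) q → (P ^ω) (toℕ j + q * p) ≡ letter (lookup w j)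
  Pω-low j q = begin
    lookup P ((toℕ j + q * p) mod p) ≡⟨ cong (lookup P) index ⟩
    lookup P (inject₁ j)             ≡⟨ lookup-∷ʳ-inject₁ (map letter w) (gap f) j ⟩
    lookup (map letter w) j          ≡⟨ lookup-map j letter w ⟩
    letter (lookup w j)              ∎
    where
    open ≡-Reasoning
    index : (toℕ j + q * p) mod p ≡ inject₁ j
    index = toℕ-injective (trans (toℕ-fromℕ< _) (trans ([m+kn]%n≡m%n (toℕ j) q p)
      (trans (m<n⇒m%n≡m (≤-trans (toℕ<n j) (n≤1+n N))) (sym (toℕ-inject₁ j)))))

  Pω-high : ∀ q → (P ^ω) (N + q * p) ≡ gap f
  Pω-high q = trans (cong (lookup P) index) (lookup-∷ʳ-last (map letter w) (gap f))
    where
    index : (N + q * p) mod p ≡ fromℕ N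
    index = toℕ-injective (trans (toℕ-fromℕ< _) (trans ([m+kn]%n≡m%n N q p)
      (trans (m<n⇒m%n≡m (n<1+n N)) (sym (toℕ-fromℕ N)))))

  gapCount-Pω : ∀ q r → r ≤ N → gapCount (P ^ω) (r + q * p) ≡ q
  gapCount-Pω zero    zero    _ = refl
  gapCount-Pω (suc q) zero    _ =
    trans (gapCount-gap (P ^ω) (N + q * p) f (Pω-high q)) (cong suc (gapCount-Pω q N ≤-refl))
  gapCount-Pω q (suc r) r<N =
    trans (gapCount-letter (P ^ω) (r + q * p) _ Pω-r) (gapCount-Pω q r (≤-trans (n≤1+n r) r<N))
    where
    Pω-r : (P ^ω) (r + q * p) ≡ letter (lookup w (fromℕ< r<N))
    Pω-r = subst (λ z → (P ^ω) (z + q * p) ≡ letter (lookup w (fromℕ< r<N)))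
                 (toℕ-fromℕ< r<N) (Pω-low (fromℕ< r<N) q)

  step-low : ∀ i j q → Tseq P (suc i) (toℕ j + q * p) ≡ letter (lookup w j)
  step-low i j q = fill-letter (P ^ω) (Tseq P i) _ _ (Pω-low j q)

  step-high : ∀ i q a → Tseq P i q ≡ letter a → Tseq P (suc i) (N + q * p) ≡ letter (f a)
  step-high i q a Tq≡a =
    fill-gap (P ^ω) (Tseq P i) _ f a (Pω-high q) (trans (cong (Tseq P i) (gapCount-Pω q N ≤-refl)) Tq≡a)

  -- position x carries a fixed letter in every T_i with i > x; by induction
  -- on a bound for x, since a high position x = N + q·p depends only on q < x
  settles : ∀ bound x → x < bound → Σ[ a ∈ Grp m ] (∀ i → suc x ≤ i → Tseq P i x ≡ letter a)
  settles (suc bound) x x<bound with view x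
  ... | low j q refl = lookup w j , λ { (suc i) _ → step-low i j q }
  ... | high q refl with settles bound q (≤-trans (quotient<high N>0 q) (≤-pred x<bound))
  ...   | a , Tq≡a = f a , λ { (suc i) x<i →
            step-high i q a (Tq≡a i (≤-trans (quotient<high N>0 q) (≤-pred x<i))) }

  t : ℕ → Grp m
  t x = proj₁ (settles (suc x) x ≤-refl)

  t-limit : IsToeplitzLimit P t
  t-limit x = suc x , proj₂ (settles (suc x) x ≤-refl)

  t-low : ∀ j q → t (toℕ j + q * p) ≡ lookup w j
  t-low j q = letter-injective (trans (sym (proj₂ (t-limit x) (suc x) ≤-refl)) (step-low x j q))
    where x = toℕ j + q * p

  t-high : ∀ q → t (N + q * p) ≡ f (t q)
  t-high q = letter-injective (trans (sym (proj₂ (t-limit x) (suc x) ≤-refl))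
    (step-high x q (t q) (proj₂ (t-limit q) x (quotient<high N>0 q))))
    where x = N + q * p

-- 4. Complete additivity of a self-similar word

-- the high position of p(q+1)(b+1), resp. (a+1)p(q+1), in terms of q, b
high-times : ∀ N q b → b + (N + q * suc N) * suc b ≡ N + (b + q * suc b) * suc N
high-times = solve-∀

times-high : ∀ N q a → (N + q * suc N) + a * suc (N + q * suc N) ≡ N + (q + a * suc q) * suc N
times-high = solve-∀

module Additivity {m N : ℕ} (w : Vec (Grp m) N) (d : Grp m) (N>0 : 0 < N) (p-prime : Prime (suc N))
  (t : ℕ → Grp m)
  (t-low : ∀ j q → t (toℕ j + q * suc N) ≡ lookup w j)
  (t-high : ∀ q → t (N + q * suc N) ≡ t q ⊕ d) where

  open CyclicGroup m
  open Positions N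

  Additive : ℕ → ℕ → Set
  Additive a b = t (suc a * suc b ∸ 1) ≡ t a ⊕ t b

  t-digit : ∀ j → t (toℕ j) ≡ lookup w j
  t-digit j = trans (cong t (sym (+-identityʳ (toℕ j)))) (t-low j 0)

  additive-high-left : ∀ {a b} q → a ≡ N + q * p → Additive q b → Additive a b
  additive-high-left {a} {b} q refl IH = begin
    t (b + a * suc b)           ≡⟨ cong t (high-times N q b) ⟩
    t (N + (b + q * suc b) * p) ≡⟨ t-high _ ⟩
    t (b + q * suc b) ⊕ d       ≡⟨ cong (_⊕ d) IH ⟩
    (t q ⊕ t b) ⊕ d             ≡⟨ ⊕-exchange (t q) (t b) d ⟩
    (t q ⊕ d) ⊕ t b             ≡⟨ cong (_⊕ t b) (t-high q) ⟨
    t a ⊕ t b                   ∎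
    where open ≡-Reasoning

  additive-high-right : ∀ {a b} q → b ≡ N + q * p → Additive a q → Additive a b
  additive-high-right {a} {b} q refl IH = begin
    t (b + a * suc b)           ≡⟨ cong t (times-high N q a) ⟩
    t (N + (q + a * suc q) * p) ≡⟨ t-high _ ⟩
    t (q + a * suc q) ⊕ d       ≡⟨ cong (_⊕ d) IH ⟩
    (t a ⊕ t q) ⊕ d             ≡⟨ ⊕-assoc (t a) (t q) d ⟩
    t a ⊕ (t q ⊕ d)             ≡⟨ cong (t a ⊕_) (t-high q) ⟨
    t a ⊕ t b                   ∎
    where open ≡-Reasoning

  -- both factors prime to p: σ is given by w on all three arguments
  additive-low : MultCondition w → ∀ {a b} (i j : Fin N) q₁ q₂ →
    a ≡ toℕ i + q₁ * p → b ≡ toℕ j + q₂ * p → Additive a b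
  additive-low mult {a} {b} i j q₁ q₂ a≡ b≡ with product-low p-prime i j q₁ q₂ a≡ b≡
  ... | k , q , ab≡ , k≡ij = begin
    t (suc a * suc b ∸ 1)   ≡⟨ trans (cong t ab≡) (t-low k q) ⟩
    lookup w k              ≡⟨ mult i j k k≡ij ⟩
    lookup w i ⊕ lookup w j ≡⟨ cong₂ _⊕_ (trans (cong t a≡) (t-low i q₁)) (trans (cong t b≡) (t-low j q₂)) ⟨
    t a ⊕ t b               ∎
    where open ≡-Reasoning

  -- induction on a + b: strip a factor p from a, else from b
  additive : MultCondition w → ∀ bound a b → a + b < bound → Additive a b
  additive mult (suc bound) a b a+b<bound with view a | view b
  ... | high q a≡ | _ = additive-high-left q a≡ (additive mult bound q b
          (<-≤-trans (+-monoˡ-< b (subst (q <_) (sym a≡) (quotient<high N>0 q))) (≤-pred a+b<bound)))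
  ... | low i q₁ a≡ | high q b≡ = additive-high-right q b≡ (additive mult bound a q
          (<-≤-trans (+-monoʳ-< a (subst (q <_) (sym b≡) (quotient<high N>0 q))) (≤-pred a+b<bound)))
  ... | low i q₁ a≡ | low j q₂ b≡ = additive-low mult i j q₁ q₂ a≡ b≡

  -- σ(1) = w₁ is idempotent by the condition with i = j = k = 1
  mult⇒additive : MultCondition w → CompletelyAdditive t
  mult⇒additive mult = t0≡0 , λ a b → additive mult (suc (a + b)) a b ≤-refl
    where
    one : Fin N
    one = fromℕ< N>0

    one²≡one : suc (toℕ one) % p ≡ (suc (toℕ one) * suc (toℕ one)) % p
    one²≡one = subst (λ u → suc u % p ≡ (suc u * suc u) % p) (sym (toℕ-fromℕ< N>0)) refl

    t0≡0 : t 0 ≡ fzero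
    t0≡0 = begin
      t 0          ≡⟨ cong t (toℕ-fromℕ< N>0) ⟨
      t (toℕ one)  ≡⟨ t-digit one ⟩
      lookup w one ≡⟨ idempotent⇒zero (lookup w one)
                        (mult one one one one²≡one) ⟩
      fzero        ∎
      where open ≡-Reasoning

  additive⇒mult : CompletelyAdditive t → MultCondition w
  additive⇒mult (_ , add) i j k k≡ij
    with product-low p-prime i j 0 0 (sym (+-identityʳ _)) (sym (+-identityʳ _))
  ... | k′ , q , ij≡ , k′≡ij = begin
    lookup w k                  ≡⟨ cong (lookup w) (residue-injective k k′ (trans k≡ij (sym k′≡ij))) ⟩
    lookup w k′                 ≡⟨ trans (cong t ij≡) (t-low k′ q) ⟨
    t (suc (toℕ i) * suc (toℕ j) ∸ 1) ≡⟨ add (toℕ i) (toℕ j) ⟩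
    t (toℕ i) ⊕ t (toℕ j)       ≡⟨ cong₂ _⊕_ (t-digit i) (t-digit j) ⟩
    lookup w i ⊕ lookup w j     ∎
    where open ≡-Reasoning

  additive⇔mult : CompletelyAdditive t ⇔ MultCondition w
  additive⇔mult = mk⇔ additive⇒mult mult⇒additive

mainTheorem15 : ∀ {m n} (w : Vec (Grp m) n) (d : Grp m) → Prime (suc n) →
    Σ[ t ∈ (ℕ → Grp m) ] (IsToeplitzLimit (pattern-wρ w d) t
    × (CompletelyAdditive t ⇔ MultCondition w))
mainTheorem15 {n = zero}  w d p-prime = ⊥-elim (¬prime[1] p-prime)
mainTheorem15 {n = suc N} w d p-prime =
  t , t-limit , Additivity.additive⇔mult w d (s≤s z≤n) p-prime t t-low t-high
  where open Toeplitz w (ρ d) (s≤s z≤n)
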